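{- Let $\mathfrak X=(X,\mathcal T,f)$ be a dynamical system, let $[\![\cdot]\!]$ be an intuitionistic valuation on $\mathfrak X$ and $[\![\cdot]\!]^c$ a classical valuation on $\mathfrak X$ such that $([\![p]\!]^c)^\circ=[\![p]\!]$ for every propositional variable $p$. Then $[\![\varphi]\!]=[\![\varphi^\blacksquare]\!]^c$ for every $\varphi\in\mathcal L_*$.
   Context: $\mathcal L_*$ is given by $\varphi::=\bot\mid p\mid\varphi\wedge\varphi\mid\varphi\vee\varphi\mid\varphi\to\varphi\mid{\circ}\varphi\mid\Diamond\varphi\mid\Box\varphi\mid\forall\varphi$. A dynamical system is $(X,\mathcal T,f)$ with $f$ continuous; $A^\circ$ denotes the interior of $A$. An intuitionistic valuation assigns open sets: $[\![\bot]\!]=\varnothing$, $[\![p]\!]$ open, $\wedge,\vee$ as intersection/union, $[\![\varphi\to\psi]\!]=((X\setminus[\![\varphi]\!])\cup[\![\psi]\!])^\circ$, $[\![{\circ}\varphi]\!]=f^{ -1}[\![\varphi]\!]$, $[\![\Diamond\varphi]\!]=\bigcup_{n<\omega}f^{ -n}[\![\varphi]\!]$, $[\![\Box\varphi]\!]=(\bigcap_{n<\omega}f^{ -n}[\![\varphi]\!])^\circ$, $[\![\forall\varphi]\!]=X$ if $[\![\varphi]\!]=X$ and $\varnothing$ otherwise. The classical language $\mathcal L^C$ has $\bot$, variables, $\to$, $\blacksquare$, ${\circ}$, $\Box$, $\forall$, with $\neg,\wedge,\vee$ defined classically and $\Diamond\varphi:=\neg\Box\neg\varphi$. A classical valuation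 assigns arbitrary subsets: $[\![\bot]\!]^c=\varnothing$, $[\![p]\!]^c\subseteq X$ arbitrary, $[\![\varphi\to\psi]\!]^c=(X\setminus[\![\varphi]\!]^c)\cup[\![\psi]\!]^c$, $[\![\blacksquare\varphi]\!]^c=([\![\varphi]\!]^c)^\circ$, $[\![{\circ}\varphi]\!]^c=f^{ -1}[\![\varphi]\!]^c$, $[\![\Box\varphi]\!]^c=\bigcap_{n<\omega}f^{ -n}[\![\varphi]\!]^c$, $[\![\forall\varphi]\!]^c=X$ if $[\![\varphi]\!]^c=X$ and $\varnothing$ otherwise. The translation $\varphi\mapsto\varphi^\blacksquare$ is: $\bot^\blacksquare=\bot$, $p^\blacksquare=\blacksquare p$, $(\varphi\odot\psi)^\blacksquare=\varphi^\blacksquare\odot\psi^\blacksquare$ for $\odot\in\{\wedge,\vee\}$, $(\varphi\to\psi)^\blacksquare=\blacksquare(\varphi^\blacksquare\to\psi^\blacksquare)$, $(\Box\varphi)^\blacksquare=\blacksquare\Box\varphi^\blacksquare$, $(\boxdot\varphi)^\blacksquare=\boxdot\varphi^\blacksquare$ for $\boxdot\in\{{\circ},\Diamond,\forall\}$. -}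

module Defs where

open import Data.Nat using (ℕ; zero; suc)
open import Data.Product using (Σ; _×_; _,_)
open import Data.Sum using (_⊎_)
open import Data.Empty using (⊥)
open import Data.Unit using (⊤)
open import Relation.Nullary using (¬_)
open import Relation.Unary using (Pred; _⊆_; _≐_)
open import Level using (0ℓ)

-- Topological spaces (predicative presentation).
-- The opens are given by a type of codes `Opn` with extensions `⟨ o ⟩`.
-- A subset A is open iff it is (extensionally) the extension of a code.

record Topology (X : Set) : Set₁ where
  field
    Opn    : Set
    ⟨_⟩    : Opn → Pred X 0ℓ
  IsOpen : Pred X 0ℓ → Set
  IsOpen A = Σ Opn λ o → ⟨ o ⟩ ≐ A
  field
    whole-open : IsOpen (λ _ → ⊤)
    ∩-open     : ∀ o₁ o₂ → IsOpen (λ x → ⟨ o₁ ⟩ x × ⟨ o₂ ⟩ x)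
    ⋃-open     : (I : Set) (U : I → Opn) → IsOpen (λ x → Σ I λ i → ⟨ U i ⟩ x)

  int : Pred X 0ℓ → Pred X 0ℓ
  int A x = Σ Opn λ o → ⟨ o ⟩ x × (⟨ o ⟩ ⊆ A)

open Topology public

iter : {X : Set} → (X → X) → ℕ → X → X
iter f zero    x = x
iter f (suc n) x = f (iter f n x)

record DynSys : Set₁ where
  field
    X    : Set
    𝒯    : Topology X
    f    : X → X
    cont : ∀ o → IsOpen 𝒯 (λ x → ⟨_⟩ 𝒯 o (f x))

data Form : Set where
  ⊥'  : Form
  var : ℕ → Form
  _∧'_ _∨'_ _⇒_ : Form → Form → Form
  ○ ◇ □ ∀' : Form → Form

data CForm : Set where
  ⊥ᶜ   : CForm
  varᶜ : ℕ → CForm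
  _⇒ᶜ_ : CForm → CForm → CForm
  ■ ○ᶜ □ᶜ ∀ᶜ : CForm → CForm

¬ᶜ : CForm → CForm
¬ᶜ φ = φ ⇒ᶜ ⊥ᶜ

_∧ᶜ_ : CForm → CForm → CForm
φ ∧ᶜ ψ = ¬ᶜ (φ ⇒ᶜ ¬ᶜ ψ)

_∨ᶜ_ : CForm → CForm → CForm
φ ∨ᶜ ψ = ¬ᶜ φ ⇒ᶜ ψ

◇ᶜ : CForm → CForm
◇ᶜ φ = ¬ᶜ (□ᶜ (¬ᶜ φ))

tr : Form → CForm
tr ⊥'      = ⊥ᶜ
tr (var p) = ■ (varᶜ p)
tr (φ ∧' ψ) = tr φ ∧ᶜ tr ψ
tr (φ ∨' ψ) = tr φ ∨ᶜ tr ψ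
tr (φ ⇒ ψ) = ■ (tr φ ⇒ᶜ tr ψ)
tr (□ φ)   = ■ (□ᶜ (tr φ))
tr (○ φ)   = ○ᶜ (tr φ)
tr (◇ φ)   = ◇ᶜ (tr φ)
tr (∀' φ)  = ∀ᶜ (tr φ)

module _ (𝔛 : DynSys) where
  open DynSys 𝔛

  record IValuation : Set₁ where
    field
      val     : ℕ → Pred X 0ℓ
      val-open : ∀ p → IsOpen 𝒯 (val p)

  ⟦_⟧ᵢ : Form → (ℕ → Pred X 0ℓ) → Pred X 0ℓ
  ⟦ ⊥' ⟧ᵢ     V x = ⊥
  ⟦ var p ⟧ᵢ  V x = V p x
  ⟦ φ ∧' ψ ⟧ᵢ V x = ⟦ φ ⟧ᵢ V x × ⟦ ψ ⟧ᵢ V x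
  ⟦ φ ∨' ψ ⟧ᵢ V x = ⟦ φ ⟧ᵢ V x ⊎ ⟦ ψ ⟧ᵢ V x
  ⟦ φ ⇒ ψ ⟧ᵢ  V x = int 𝒯 (λ y → ¬ ⟦ φ ⟧ᵢ V y ⊎ ⟦ ψ ⟧ᵢ V y) x
  ⟦ ○ φ ⟧ᵢ    V x = ⟦ φ ⟧ᵢ V (f x)
  ⟦ ◇ φ ⟧ᵢ    V x = Σ ℕ λ n → ⟦ φ ⟧ᵢ V (iter f n x)
  ⟦ □ φ ⟧ᵢ    V x = int 𝒯 (λ y → ∀ n → ⟦ φ ⟧ᵢ V (iter f n y)) x
  ⟦ ∀' φ ⟧ᵢ   V x = ∀ y → ⟦ φ ⟧ᵢ V y

  ⟦_⟧ᶜ : CForm → (ℕ → Pred X 0ℓ) → Pred X 0ℓ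
  ⟦ ⊥ᶜ ⟧ᶜ     V x = ⊥
  ⟦ varᶜ p ⟧ᶜ V x = V p x
  ⟦ φ ⇒ᶜ ψ ⟧ᶜ V x = ¬ ⟦ φ ⟧ᶜ V x ⊎ ⟦ ψ ⟧ᶜ V x
  ⟦ ■ φ ⟧ᶜ    V x = int 𝒯 (⟦ φ ⟧ᶜ V) x
  ⟦ ○ᶜ φ ⟧ᶜ   V x = ⟦ φ ⟧ᶜ V (f x)
  ⟦ □ᶜ φ ⟧ᶜ   V x = ∀ n → ⟦ φ ⟧ᶜ V (iter f n x)
  ⟦ ∀ᶜ φ ⟧ᶜ   V x = ∀ y → ⟦ φ ⟧ᶜ V y

-- Excluded middle (the paper's metatheory is classical)
LEM : Set₁
LEM = (P : Set) → P ⊎ ¬ P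

-- The translation puts ■ exactly where the intuitionistic
-- semantics takes an interior (variables, →, □), so apart from the variables,
-- which are the hypothesis, every case is a congruence of the set operation
-- interpreting the connective. The connectives ∧, ∨ and ◇ of 𝓛^C are
-- abbreviations built from → and ⊥; by excluded middle they denote
-- intersection, union and the union of the preimages f⁻ⁿ.
module Submission where

open import Defs
open import Data.Nat using (ℕ)
open import Data.Product as Product using (Σ; _,_)
open import Data.Sum as Sum using (inj₁; inj₂)
open import Level using (0ℓ)
open import Relation.Nullary using (¬_)
open import Relation.Nullary.Decidable using (fromSum; decidable-stable)
open import Relation.Unary using (Pred; _⊆_; _≐_; _∩_; _∪_; ∁; _⊢_; Universal)
open import Relation.Unary.Properties using (≐-refl; ≐-sym; ≐-trans)

¬¬-elim : LEM → {P : Set} → ¬ ¬ P → P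
¬¬-elim lem {P} = decidable-stable (fromSum (lem P))

module _ {X : Set} where

  Eventually : (X → X) → Pred X 0ℓ → Pred X 0ℓ
  Eventually g A x = Σ ℕ λ n → A (iter g n x)

  Always : (X → X) → Pred X 0ℓ → Pred X 0ℓ
  Always g A x = ∀ n → A (iter g n x)

  Everywhere : Pred X 0ℓ → Pred X 0ℓ
  Everywhere A _ = Π[ A ]

  int-mono : (𝒯 : Topology X) {A B : Pred X 0ℓ} → A ⊆ B → int 𝒯 A ⊆ int 𝒯 B
  int-mono 𝒯 A⊆B (o , x∈o , o⊆A) = o , x∈o , λ y∈o → A⊆B (o⊆A y∈o)

  module _ {A B : Pred X 0ℓ} where

    int-cong : (𝒯 : Topology X) → A ≐ B → int 𝒯 A ≐ int 𝒯 B
    int-cong 𝒯 (A⊆B , B⊆A) = int-mono 𝒯 A⊆B , int-mono 𝒯 B⊆A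

    ∁-cong : A ≐ B → ∁ A ≐ ∁ B
    ∁-cong (A⊆B , B⊆A) = (λ ¬a b → ¬a (B⊆A b)) , (λ ¬b a → ¬b (A⊆B a))

    ⊢-cong : (g : X → X) → A ≐ B → g ⊢ A ≐ g ⊢ B
    ⊢-cong g (A⊆B , B⊆A) = A⊆B , B⊆A

    Eventually-cong : (g : X → X) → A ≐ B → Eventually g A ≐ Eventually g B
    Eventually-cong g (A⊆B , B⊆A) = Product.map₂ A⊆B , Product.map₂ B⊆A

    Always-cong : (g : X → X) → A ≐ B → Always g A ≐ Always g B
    Always-cong g (A⊆B , B⊆A) = (λ a n → A⊆B (a n)) , (λ b n → B⊆A (b n))

    Everywhere-cong : A ≐ B → Everywhere A ≐ Everywhere B
    Everywhere-cong (A⊆B , B⊆A) = (λ a y → A⊆B (a y)) , (λ b y → B⊆A (b y))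


  module _ {A A′ B B′ : Pred X 0ℓ} where

    ∩-cong : A ≐ A′ → B ≐ B′ → A ∩ B ≐ A′ ∩ B′
    ∩-cong (A⊆A′ , A′⊆A) (B⊆B′ , B′⊆B) = Product.map A⊆A′ B⊆B′ , Product.map A′⊆A B′⊆B

    ∪-cong : A ≐ A′ → B ≐ B′ → A ∪ B ≐ A′ ∪ B′
    ∪-cong (A⊆A′ , A′⊆A) (B⊆B′ , B′⊆B) = Sum.map A⊆A′ B⊆B′ , Sum.map A′⊆A B′⊆B

module _ (lem : LEM) (𝔛 : DynSys) (V : ℕ → Pred (DynSys.X 𝔛) 0ℓ) where
  open DynSys 𝔛

  ⟦_⟧ : CForm → Pred X 0ℓ
  ⟦ φ ⟧ = ⟦_⟧ᶜ 𝔛 φ V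

  ⟦∧ᶜ⟧≐∩ : ∀ φ ψ → ⟦ φ ∧ᶜ ψ ⟧ ≐ ⟦ φ ⟧ ∩ ⟦ ψ ⟧
  ⟦∧ᶜ⟧≐∩ φ ψ = to , from
    where
    to : ∀ {x} → ⟦ φ ∧ᶜ ψ ⟧ x → (⟦ φ ⟧ ∩ ⟦ ψ ⟧) x
    to (inj₁ ¬[¬a∨¬b]) = ¬¬-elim lem (λ ¬a → ¬[¬a∨¬b] (inj₁ ¬a))
                       , ¬¬-elim lem (λ ¬b → ¬[¬a∨¬b] (inj₂ (inj₁ ¬b)))

    from : ∀ {x} → (⟦ φ ⟧ ∩ ⟦ ψ ⟧) x → ⟦ φ ∧ᶜ ψ ⟧ x
    from (a , b) = inj₁ λ { (inj₁ ¬a) → ¬a a ; (inj₂ (inj₁ ¬b)) → ¬b b }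

  ⟦∨ᶜ⟧≐∪ : ∀ φ ψ → ⟦ φ ∨ᶜ ψ ⟧ ≐ ⟦ φ ⟧ ∪ ⟦ ψ ⟧
  ⟦∨ᶜ⟧≐∪ φ ψ = Sum.map₁ (λ ¬¬a → ¬¬-elim lem (λ ¬a → ¬¬a (inj₁ ¬a)))
             , Sum.map₁ (λ a → λ { (inj₁ ¬a) → ¬a a })

  ⟦◇ᶜ⟧≐Eventually : ∀ φ → ⟦ ◇ᶜ φ ⟧ ≐ Eventually f ⟦ φ ⟧
  ⟦◇ᶜ⟧≐Eventually φ = to , from
    where
    to : ∀ {x} → ⟦ ◇ᶜ φ ⟧ x → Eventually f ⟦ φ ⟧ x
    to (inj₁ ¬always¬) = ¬¬-elim lem λ never → ¬always¬ λ n → inj₁ λ a → never (n , a)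

    from : ∀ {x} → Eventually f ⟦ φ ⟧ x → ⟦ ◇ᶜ φ ⟧ x
    from (n , a) = inj₁ λ always¬ → Sum.[ (λ ¬a → ¬a a) , (λ ()) ] (always¬ n)

module _ (lem : LEM) (𝔛 : DynSys) (V Vc : ℕ → Pred (DynSys.X 𝔛) 0ℓ)
         (int-Vc≐V : ∀ p → int (DynSys.𝒯 𝔛) (Vc p) ≐ V p) where
  open DynSys 𝔛

  tr-sound : ∀ φ → ⟦_⟧ᵢ 𝔛 φ V ≐ ⟦_⟧ᶜ 𝔛 (tr φ) Vc
  tr-sound ⊥'       = ≐-refl
  tr-sound (var p)  = ≐-sym (int-Vc≐V p)
  tr-sound (φ ∧' ψ) = ≐-trans (∩-cong (tr-sound φ) (tr-sound ψ))
                              (≐-sym (⟦∧ᶜ⟧≐∩ lem 𝔛 Vc (tr φ) (tr ψ)))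
  tr-sound (φ ∨' ψ) = ≐-trans (∪-cong (tr-sound φ) (tr-sound ψ))
                              (≐-sym (⟦∨ᶜ⟧≐∪ lem 𝔛 Vc (tr φ) (tr ψ)))
  tr-sound (φ ⇒ ψ)  = int-cong 𝒯 (∪-cong (∁-cong (tr-sound φ)) (tr-sound ψ))
  tr-sound (○ φ)    = ⊢-cong f (tr-sound φ)
  tr-sound (◇ φ)    = ≐-trans (Eventually-cong f (tr-sound φ))
                              (≐-sym (⟦◇ᶜ⟧≐Eventually lem 𝔛 Vc (tr φ)))
  tr-sound (□ φ)    = int-cong 𝒯 (Always-cong f (tr-sound φ))
  tr-sound (∀' φ)   = Everywhere-cong (tr-sound φ)

lemma11p6 : LEM → (𝔛 : DynSys) → (I : IValuation 𝔛) → (Vc : ℕ → Pred (DynSys.X 𝔛) 0ℓ) →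
    (∀ p → Topology.int (DynSys.𝒯 𝔛) (Vc p) ≐ IValuation.val I p) →
    ∀ φ → ⟦_⟧ᵢ 𝔛 φ (IValuation.val I) ≐ ⟦_⟧ᶜ 𝔛 (tr φ) Vc
lemma11p6 lem 𝔛 I Vc int-Vc≐V = tr-sound lem 𝔛 (IValuation.val I) Vc int-Vc≐V
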